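{- Let $n\ge2$. If $\mathsf u\in\mathcal S_n$, then $\operatorname{rot}(\mathsf u)\in\mathcal S_n$.
   Context: $\widetilde S_n$ is the affine symmetric group (bijections $w:\mathbb Z\to\mathbb Z$ with $w(i+n)=w(i)+n$ and $\sum_{i=1}^n w(i)=\binom{n+1}{2}$, multiplied by composition). $s_j$ interchanges $j+kn$ and $j+1+kn$ for all $k$ (index mod $n$). $\boldsymbol\lambda_n$ is the word $[s_0,\dots,s_{n-1}]$ repeated $n-1$ times; its $j$-th letter ($1\le j\le n(n-1)$) is $s_{j-1}$. A subword is $\mathsf u=[u_1,\dots,u_{n(n-1)}]$ with each $u_j$ equal to either the $j$-th letter (a take) or the identity $e$ (a skip). $\mathcal S_n$ is the set of subwords with exactly $2n-2$ skips and $u_1\cdots u_{n(n-1)}=e$ (maximal distinguished subwords). The rotation $\operatorname{rot}(\mathsf u)$ is the subword whose position $1$ is a skip iff position $n(n-1)$ of $\mathsf u$ is a skip, and whose position $i\ge 2$ is a skip iff position $i-1$ of $\mathsf u$ is a skip. -}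

module Defs where

open import Data.Bool using (Bool; true; false; if_then_else_)
open import Data.Nat using (ℕ; zero; suc; _*_; _∸_; _≡ᵇ_; _%_)
open import Data.Integer using (ℤ; _%ℕ_) renaming (suc to sucℤ; pred to predℤ)
open import Data.List using (List; []; _∷_; length; reverse)
open import Data.Product using (_×_)
open import Relation.Binary.PropositionalEquality using (_≡_)

-- Simple reflection s_j of the affine symmetric group S̃_n, as a bijection
-- ℤ → ℤ: it interchanges j + kn and j + 1 + kn for all k (j taken mod n).
-- Only meaningful for n ≥ 2 (the case n = 0 is a dummy).
s : (n j : ℕ) → ℤ → ℤ
s zero    j z = z
s (suc m) j z =
  if (z %ℕ suc m) ≡ᵇ (j % suc m) then sucℤ z
  else if (z %ℕ suc m) ≡ᵇ (suc j % suc m) then predℤ z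
  else z

-- A subword of λ_n is encoded as a list of booleans, one per position,
-- with  true = take  and  false = skip (the identity e).
Subword : Set
Subword = List Bool

-- The letter at (0-indexed) position p of λ_n = [s_0,…,s_{n-1}]^(n-1)
-- is s_{p mod n}.  evalFrom n p bs  is the product u_{p+1} ⋯ u_{p+k}
-- (as a function ℤ → ℤ, composition: (u v)(z) = u (v z)) of the
-- entries bs occupying positions p+1 … p+k (1-indexed).
evalFrom : (n p : ℕ) → Subword → ℤ → ℤ
evalFrom n p []            z = z
evalFrom n p (true  ∷ bs)  z = s n p (evalFrom n (suc p) bs z)
evalFrom n p (false ∷ bs)  z = evalFrom n (suc p) bs z

product : (n : ℕ) → Subword → ℤ → ℤ
product n u = evalFrom n 0 u

skips : Subword → ℕ
skips []           = 0
skips (true  ∷ bs) = skips bs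
skips (false ∷ bs) = suc (skips bs)

InS : ℕ → Subword → Set
InS n u = (length u ≡ n * (n ∸ 1))
        × (skips u ≡ 2 * n ∸ 2)
        × (∀ (z : ℤ) → product n u z ≡ z)

-- rot: new position 1 is old position n(n-1) (the last); new position i ≥ 2
-- is old position i-1.
rot : Subword → Subword
rot u with reverse u
... | []       = []
... | (x ∷ xs) = x ∷ reverse xs

{-# OPTIONS --safe #-}
-- Write u = xs ∷ʳ b and L = length xs, so that n ∣ L + 1 and rot u = b ∷ xs.  Conjugation by
-- the translation τ z = z + 1 sends s_j to s_{j+1}, so xs read from position 2 multiplies to
-- τ E τ⁻¹, where E is its product read from position 1.  Let b_L be s_L or e according to b.
-- If E b_L = e then also b_L E = e, s_L being an involution, and the product of rot u is
-- b_{L+1} τ E τ⁻¹ = τ b_L E τ⁻¹ = e because s_{L+1} = s_0.  Length and number of skips are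
-- additive over concatenation, hence invariant under rotation.
module Submission where

open import Defs
open import Data.Bool using (Bool; true; false; if_then_else_)
open import Data.Nat
  using (ℕ; zero; suc; _+_; _∸_; _%_; _/_; _≡ᵇ_; _≤_; _<_; _≟_; NonZero; s≤s; z≤n)
open import Data.Nat.Properties
  using (+-comm; +-identityʳ; +-suc; +-∸-assoc; m+n∸n≡m; m∸n≤m; <⇒≤; m≤n⇒m<n∨m≡n; 1+n≢n)
open import Data.Nat.DivMod using (m≡m%n+[m/n]*n; [m+kn]%n≡m%n; m<n⇒m%n≡m; n%n≡0; m%n<n)
open import Data.Integer using (ℤ; +_; -[1+_]; _%ℕ_) renaming (suc to sucℤ; pred to predℤ)
import Data.Integer.Properties as ℤ
open import Data.Integer.DivMod using (n%ℕd<d)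
open import Data.Nat.Divisibility using (_∣_; n∣m⇒m%n≡0; m∣m*n)
open import Data.List using ([]; _∷_; [_]; _++_; _∷ʳ_; length; reverse)
open import Data.List.Properties using (length-++; length-++-comm; reverse-++; reverse-involutive)
open import Data.List.Reverse using (reverseView; []; _∶_∶ʳ_)
open import Data.Product using (_,_)
open import Data.Sum using (inj₁; inj₂)
open import Function using (id; _∘_)
open import Relation.Nullary using (yes; no)
open import Relation.Nullary.Decidable using (dec-true; dec-false)
open import Relation.Binary.PropositionalEquality
  using (_≡_; _≢_; _≗_; refl; sym; trans; cong; cong₂; subst; module ≡-Reasoning)

suc-% : ∀ j n .{{_ : NonZero n}} → suc j % n ≡ suc (j % n) % n
suc-% j n = trans (cong (λ r → suc r % n) (m≡m%n+[m/n]*n j n))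
                  ([m+kn]%n≡m%n (suc (j % n)) (j / n) n)

predMod : ℕ → ℕ → ℕ
predMod n zero    = n ∸ 1
predMod n (suc a) = a

predMod-suc-% : ∀ {a} n .{{_ : NonZero n}} → a < n → predMod n (suc a % n) ≡ a
predMod-suc-% {a} n a<n with m≤n⇒m<n∨m≡n a<n
... | inj₁ 1+a<n rewrite m<n⇒m%n≡m 1+a<n = refl
predMod-suc-% {a} .(suc a) a<n | inj₂ refl = cong (predMod (suc a)) (n%n≡0 (suc a))

suc-%-injective : ∀ {a b} n .{{_ : NonZero n}} → a < n → b < n → suc a % n ≡ suc b % n → a ≡ b
suc-%-injective n a<n b<n eq =
  trans (sym (predMod-suc-% n a<n)) (trans (cong (predMod n) eq) (predMod-suc-% n b<n))

suc-%-≢ : ∀ {a} n .{{_ : NonZero n}} → 1 < n → a < n → suc a % n ≢ a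
suc-%-≢ n 1<n a<n eq with trans (cong (predMod n) (sym eq)) (predMod-suc-% n a<n)
suc-%-≢ {zero}  (suc (suc _)) (s≤s (s≤s z≤n)) _ _ | ()
suc-%-≢ {suc _} _             _               _ _ | a≡1+a = 1+n≢n (sym a≡1+a)

-- The remainder of -t modulo n, for t < n: the form in which _%ℕ_ computes on -[1+ j ].
negMod : ℕ → ℕ → ℕ
negMod n zero    = 0
negMod n (suc t) = n ∸ suc t

-[1+]-%ℕ : ∀ j n .{{_ : NonZero n}} → -[1+ j ] %ℕ n ≡ negMod n (suc j % n)
-[1+]-%ℕ j n with suc j % n
... | zero  = refl
... | suc _ = refl

negMod-suc-% : ∀ {t} n .{{_ : NonZero n}} → t < n → negMod n t ≡ suc (negMod n (suc t % n)) % n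
negMod-suc-% {t} n t<n with m≤n⇒m<n∨m≡n t<n
negMod-suc-% {zero}  (suc n) t<n | inj₁ 1<1+n rewrite m<n⇒m%n≡m 1<1+n = sym (n%n≡0 (suc n))
negMod-suc-% {suc t} (suc n) t<n | inj₁ (s≤s 1+t<n) rewrite m<n⇒m%n≡m (s≤s 1+t<n) = sym (begin
  suc (n ∸ suc t) % suc n  ≡⟨ cong (_% suc n) (+-∸-assoc 1 (<⇒≤ 1+t<n)) ⟨
  (n ∸ t) % suc n          ≡⟨ m<n⇒m%n≡m (s≤s (m∸n≤m n t)) ⟩
  n ∸ t                    ∎)
  where open ≡-Reasoning
negMod-suc-% {zero}  .1             t<n | inj₂ refl = refl
negMod-suc-% {suc t} .(suc (suc t)) t<n | inj₂ refl = trans (m+n∸n≡m 1 t)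
  (cong (λ r → suc (negMod (suc (suc t)) r) % suc (suc t)) (sym (n%n≡0 (suc (suc t)))))

sucℤ-%ℕ : ∀ z n .{{_ : NonZero n}} → sucℤ z %ℕ n ≡ suc (z %ℕ n) % n
sucℤ-%ℕ (+ j)    n = suc-% j n
sucℤ-%ℕ -[1+ j ] n = begin
  sucℤ -[1+ j ] %ℕ n                   ≡⟨ sucℤ-[1+]-%ℕ j n ⟩
  negMod n (j % n)                     ≡⟨ negMod-suc-% n (m%n<n j n) ⟩
  suc (negMod n (suc (j % n) % n)) % n ≡⟨ cong (λ r → suc (negMod n r) % n) (suc-% j n) ⟨
  suc (negMod n (suc j % n)) % n       ≡⟨ cong (λ r → suc r % n) (-[1+]-%ℕ j n) ⟨
  suc (-[1+ j ] %ℕ n) % n              ∎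
  where
  open ≡-Reasoning
  sucℤ-[1+]-%ℕ : ∀ j n .{{_ : NonZero n}} → sucℤ -[1+ j ] %ℕ n ≡ negMod n (j % n)
  sucℤ-[1+]-%ℕ zero    (suc _) = refl
  sucℤ-[1+]-%ℕ (suc j) n       = -[1+]-%ℕ j n

sucℤ-%ℕ-≡ : ∀ {n} z j .{{_ : NonZero n}} → z %ℕ n ≡ j % n → sucℤ z %ℕ n ≡ suc j % n
sucℤ-%ℕ-≡ {n} z j eq =
  trans (sucℤ-%ℕ z n) (trans (cong (λ r → suc r % n) eq) (sym (suc-% j n)))

sucℤ-%ℕ-≡⁻¹ : ∀ {n} z j .{{_ : NonZero n}} → sucℤ z %ℕ n ≡ suc j % n → z %ℕ n ≡ j % n
sucℤ-%ℕ-≡⁻¹ {n} z j eq =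
  suc-%-injective n (n%ℕd<d z n) (m%n<n j n) (trans (sym (sucℤ-%ℕ z n)) (trans eq (suc-% j n)))

s-up : ∀ {n} j z .{{_ : NonZero n}} → z %ℕ n ≡ j % n → s n j z ≡ sucℤ z
s-up {suc m} j z up rewrite dec-true (z %ℕ suc m ≟ j % suc m) up = refl

s-down : ∀ {n} j z .{{_ : NonZero n}} → z %ℕ n ≢ j % n → z %ℕ n ≡ suc j % n → s n j z ≡ predℤ z
s-down {suc m} j z ¬up down
  rewrite dec-false (z %ℕ suc m ≟ j % suc m) ¬up
        | dec-true (z %ℕ suc m ≟ suc j % suc m) down = refl

s-fix : ∀ {n} j z .{{_ : NonZero n}} → z %ℕ n ≢ j % n → z %ℕ n ≢ suc j % n → s n j z ≡ z
s-fix {suc m} j z ¬up ¬down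
  rewrite dec-false (z %ℕ suc m ≟ j % suc m) ¬up
        | dec-false (z %ℕ suc m ≟ suc j % suc m) ¬down = refl

s-shift : ∀ n j z → s n (suc j) (sucℤ z) ≡ sucℤ (s n j z)
s-shift zero      j z = refl
s-shift n@(suc _) j z with z %ℕ n ≟ j % n | z %ℕ n ≟ suc j % n
... | yes up  | _        =
  trans (s-up (suc j) (sucℤ z) (sucℤ-%ℕ-≡ z j up)) (cong sucℤ (sym (s-up j z up)))
... | no ¬up  | yes down = begin
  s n (suc j) (sucℤ z) ≡⟨ s-down (suc j) (sucℤ z) ¬up′ (sucℤ-%ℕ-≡ z (suc j) down) ⟩
  predℤ (sucℤ z)       ≡⟨ ℤ.pred-suc z ⟩
  z                    ≡⟨ ℤ.suc-pred z ⟨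
  sucℤ (predℤ z)       ≡⟨ cong sucℤ (s-down j z ¬up down) ⟨
  sucℤ (s n j z)       ∎
  where
  open ≡-Reasoning
  ¬up′ : sucℤ z %ℕ n ≢ suc j % n
  ¬up′ = ¬up ∘ sucℤ-%ℕ-≡⁻¹ z j
... | no ¬up  | no ¬down =
  trans (s-fix (suc j) (sucℤ z) ¬up′ ¬down′) (cong sucℤ (sym (s-fix j z ¬up ¬down)))
  where
  ¬up′ : sucℤ z %ℕ n ≢ suc j % n
  ¬up′ = ¬up ∘ sucℤ-%ℕ-≡⁻¹ z j
  ¬down′ : sucℤ z %ℕ n ≢ suc (suc j) % n
  ¬down′ = ¬down ∘ sucℤ-%ℕ-≡⁻¹ z (suc j)

s-cong-% : ∀ {n j j′} z .{{_ : NonZero n}} → j % n ≡ j′ % n → s n j z ≡ s n j′ z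
s-cong-% {n@(suc _)} {j} {j′} z eq =
  cong₂ (λ a b → if z %ℕ n ≡ᵇ a then sucℤ z else if z %ℕ n ≡ᵇ b then predℤ z else z)
        eq (trans (suc-% j n) (trans (cong (λ r → suc r % n) eq) (sym (suc-% j′ n))))

s-involutive : ∀ n → 1 < n → ∀ j z → s n j (s n j z) ≡ z
s-involutive n@(suc _) 1<n j z with z %ℕ n ≟ j % n | z %ℕ n ≟ suc j % n
... | yes up  | _        = begin
  s n j (s n j z) ≡⟨ cong (s n j) (s-up j z up) ⟩
  s n j (sucℤ z)  ≡⟨ s-down j (sucℤ z) ¬up′ (sucℤ-%ℕ-≡ z j up) ⟩
  predℤ (sucℤ z)  ≡⟨ ℤ.pred-suc z ⟩
  z               ∎
  where
  open ≡-Reasoning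
  ¬up′ : sucℤ z %ℕ n ≢ j % n
  ¬up′ up′ =
    suc-%-≢ n 1<n (m%n<n j n) (trans (sym (suc-% j n)) (trans (sym (sucℤ-%ℕ-≡ z j up)) up′))
... | no ¬up  | yes down = begin
  s n j (s n j z) ≡⟨ cong (s n j) (s-down j z ¬up down) ⟩
  s n j (predℤ z) ≡⟨ s-up j (predℤ z) (sucℤ-%ℕ-≡⁻¹ (predℤ z) j down′) ⟩
  sucℤ (predℤ z)  ≡⟨ ℤ.suc-pred z ⟩
  z               ∎
  where
  open ≡-Reasoning
  down′ : sucℤ (predℤ z) %ℕ n ≡ suc j % n
  down′ = trans (cong (_%ℕ n) (ℤ.suc-pred z)) down
... | no ¬up  | no ¬down = trans (cong (s n j) (s-fix j z ¬up ¬down)) (s-fix j z ¬up ¬down)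

evalFrom-++ : ∀ n p xs ys z →
              evalFrom n p (xs ++ ys) z ≡ evalFrom n p xs (evalFrom n (p + length xs) ys z)
evalFrom-++ n p []           ys z rewrite +-identityʳ p = refl
evalFrom-++ n p (true ∷ xs)  ys z rewrite +-suc p (length xs) =
  cong (s n p) (evalFrom-++ n (suc p) xs ys z)
evalFrom-++ n p (false ∷ xs) ys z rewrite +-suc p (length xs) = evalFrom-++ n (suc p) xs ys z

evalFrom-shift : ∀ n p xs z → evalFrom n (suc p) xs (sucℤ z) ≡ sucℤ (evalFrom n p xs z)
evalFrom-shift n p []           z = refl
evalFrom-shift n p (true ∷ xs)  z =
  trans (cong (s n (suc p)) (evalFrom-shift n (suc p) xs z)) (s-shift n p (evalFrom n (suc p) xs z))
evalFrom-shift n p (false ∷ xs) z = evalFrom-shift n (suc p) xs z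

evalFrom-suc : ∀ n p xs z → evalFrom n (suc p) xs z ≡ sucℤ (evalFrom n p xs (predℤ z))
evalFrom-suc n p xs z =
  trans (cong (evalFrom n (suc p) xs) (sym (ℤ.suc-pred z))) (evalFrom-shift n p xs (predℤ z))

rot-∷ʳ : ∀ xs (b : Bool) → rot (xs ∷ʳ b) ≡ b ∷ xs
rot-∷ʳ xs b with reverse (xs ∷ʳ b) | reverse-++ xs (b ∷ [])
... | _ | refl = cong (b ∷_) (reverse-involutive xs)

rot-invariant : (f : Subword → ℕ) → (∀ xs {ys} → f (xs ++ ys) ≡ f xs + f ys) →
                ∀ u → f (rot u) ≡ f u
rot-invariant f f-++ u with reverseView u
... | []            = refl
... | xs ∶ _ ∶ʳ b rewrite rot-∷ʳ xs b =
  trans (f-++ (b ∷ [])) (trans (+-comm (f (b ∷ [])) (f xs)) (sym (f-++ xs)))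

skips-++ : ∀ xs {ys} → skips (xs ++ ys) ≡ skips xs + skips ys
skips-++ []           = refl
skips-++ (true ∷ xs)  = skips-++ xs
skips-++ (false ∷ xs) = cong suc (skips-++ xs)

product-rotate : ∀ n → 1 < n → ∀ xs b → n ∣ length (xs ∷ʳ b) →
                 product n (xs ∷ʳ b) ≗ id → product n (b ∷ xs) ≗ id
product-rotate n _ xs false _ xs∷ʳb≗id z = begin
  evalFrom n 1 xs z                        ≡⟨ evalFrom-suc n 0 xs z ⟩
  sucℤ (evalFrom n 0 xs (predℤ z))         ≡⟨ cong sucℤ (evalFrom-++ n 0 xs [ false ] (predℤ z)) ⟨
  sucℤ (product n (xs ∷ʳ false) (predℤ z)) ≡⟨ cong sucℤ (xs∷ʳb≗id (predℤ z)) ⟩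
  sucℤ (predℤ z)                           ≡⟨ ℤ.suc-pred z ⟩
  z                                        ∎
  where open ≡-Reasoning
product-rotate n@(suc _) 1<n xs true n∣ xs∷ʳb≗id z = begin
  s n 0 (evalFrom n 1 xs z)    ≡⟨ cong (s n 0) (evalFrom-suc n 0 xs z) ⟩
  s n 0 (sucℤ (E y))           ≡⟨ cong (s n 0 ∘ sucℤ) E≡s ⟩
  s n 0 (sucℤ (s n L y))       ≡⟨ cong (s n 0) (s-shift n L y) ⟨
  s n 0 (s n (suc L) (sucℤ y)) ≡⟨ cong (s n 0) (s-cong-% (sucℤ y) 1+L≡0) ⟩
  s n 0 (s n 0 (sucℤ y))       ≡⟨ s-involutive n 1<n 0 (sucℤ y) ⟩
  sucℤ y                       ≡⟨ ℤ.suc-pred z ⟩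
  z                            ∎
  where
  open ≡-Reasoning
  L : ℕ
  L = length xs
  E : ℤ → ℤ
  E = evalFrom n 0 xs
  y : ℤ
  y = predℤ z
  E≡s : E y ≡ s n L y
  E≡s = begin
    E y                               ≡⟨ cong E (s-involutive n 1<n L y) ⟨
    E (s n L (s n L y))               ≡⟨ evalFrom-++ n 0 xs [ true ] (s n L y) ⟨
    product n (xs ∷ʳ true) (s n L y)  ≡⟨ xs∷ʳb≗id (s n L y) ⟩
    s n L y                           ∎
  1+L≡0 : suc L % n ≡ 0 % n
  1+L≡0 = trans (cong (_% n) (sym (length-++-comm xs [ true ]))) (n∣m⇒m%n≡0 _ n n∣)

product-rot : ∀ n → 1 < n → ∀ u → n ∣ length u → product n u ≗ id → product n (rot u) ≗ id
product-rot n 1<n u n∣ u≗id with reverseView u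
... | []            = u≗id
... | xs ∶ _ ∶ʳ b rewrite rot-∷ʳ xs b = product-rotate n 1<n xs b n∣ u≗id

corollary5p7 : (n : ℕ) → 2 ≤ n → (u : Subword) → InS n u → InS n (rot u)
corollary5p7 n 2≤n u (length≡ , skips≡ , u≗id) =
    trans (rot-invariant length length-++ u) length≡
  , trans (rot-invariant skips skips-++ u) skips≡
  , product-rot n 2≤n u (subst (n ∣_) (sym length≡) (m∣m*n (n ∸ 1))) u≗id
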